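{- Let $X\subseteq\{\mathbf{D},\mathbf{T},\mathbf{4}\}$ with $\mathbf{D}\in X$ or $\mathbf{T}\in X$. Then for every theory $\Gamma$ of $\mathbf{LIK}X$, $\{\lozenge A: \square A\in\Gamma\}\subseteq\Gamma$.
   Context: Formulas are built from atoms by $A::=p\mid A\supset A\mid \top\mid\bot\mid A\vee A\mid A\wedge A\mid \square A\mid \lozenge A$; $\neg A$ abbreviates $A\supset\bot$. $\mathbf{LIK}X$ is the set of formulas derivable from: axioms of intuitionistic propositional logic, $\square(p\supset q)\supset(\square p\supset\square q)$, $\square(p\supset q)\supset(\lozenge p\supset\lozenge q)$, $\lozenge(p\vee q)\supset\lozenge p\vee\lozenge q$, $\square(p\vee q)\supset\lozenge p\vee\square q$, $\neg\lozenge\bot$, plus $\lozenge\top$ if $\mathbf{D}\in X$, $(\square p\supset p)\wedge(p\supset\lozenge p)$ if $\mathbf{T}\in X$, $(\square p\supset\square\square p)\wedge(\lozenge\lozenge p\supset\lozenge p)$ if $\mathbf{4}\in X$ (with substitution instances), under modus ponens and necessitation (from $A$ infer $\square A$). A theory is a set of formulas containing $\mathbf{LIK}X$ and closed under modus ponens. -}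

module Defs where

open import Data.Nat using (ℕ)
open import Data.Bool using (Bool; true; false)
open import Relation.Binary.PropositionalEquality using (_≡_)

data Form : Set where
  atom : ℕ → Form
  _⊃_  : Form → Form → Form
  ⊤'   : Form
  ⊥'   : Form
  _∨'_ : Form → Form → Form
  _∧'_ : Form → Form → Form
  □_   : Form → Form
  ◇_   : Form → Form

infixr 5 _⊃_
infixr 6 _∨'_
infixr 7 _∧'_
infix 8 □_ ◇_

¬' : Form → Form
¬' A = A ⊃ ⊥'

-- A set X ⊆ {D, T, 4}, given by its characteristic function.
record Ext : Set where
  field
    hasD : Bool
    hasT : Bool
    has4 : Bool
open Ext public

-- Derivability in LIK X.  Axioms are given as schemas, i.e. all
-- substitution instances of the axioms stated with atoms p, q, r.
data LIK (X : Ext) : Form → Set where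
  ax-K   : ∀ A B → LIK X (A ⊃ B ⊃ A)
  ax-S   : ∀ A B C → LIK X ((A ⊃ B ⊃ C) ⊃ (A ⊃ B) ⊃ A ⊃ C)
  ax-∧₁  : ∀ A B → LIK X (A ∧' B ⊃ A)
  ax-∧₂  : ∀ A B → LIK X (A ∧' B ⊃ B)
  ax-∧I  : ∀ A B → LIK X (A ⊃ B ⊃ A ∧' B)
  ax-∨₁  : ∀ A B → LIK X (A ⊃ A ∨' B)
  ax-∨₂  : ∀ A B → LIK X (B ⊃ A ∨' B)
  ax-∨E  : ∀ A B C → LIK X ((A ⊃ C) ⊃ (B ⊃ C) ⊃ A ∨' B ⊃ C)
  ax-⊥   : ∀ A → LIK X (⊥' ⊃ A)
  ax-⊤   : LIK X ⊤'
  ax-K□  : ∀ A B → LIK X (□ (A ⊃ B) ⊃ □ A ⊃ □ B)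
  ax-K◇  : ∀ A B → LIK X (□ (A ⊃ B) ⊃ ◇ A ⊃ ◇ B)
  ax-N◇∨ : ∀ A B → LIK X (◇ (A ∨' B) ⊃ ◇ A ∨' ◇ B)
  ax-□∨  : ∀ A B → LIK X (□ (A ∨' B) ⊃ ◇ A ∨' □ B)
  ax-N◇  : LIK X (¬' (◇ ⊥'))
  ax-D   : hasD X ≡ true → LIK X (◇ ⊤')
  ax-T   : hasT X ≡ true → ∀ A → LIK X ((□ A ⊃ A) ∧' (A ⊃ ◇ A))
  ax-4   : has4 X ≡ true → ∀ A → LIK X ((□ A ⊃ □ □ A) ∧' (◇ ◇ A ⊃ ◇ A))
  mp     : ∀ {A B} → LIK X (A ⊃ B) → LIK X A → LIK X B
  nec    : ∀ {A} → LIK X A → LIK X (□ A)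

record Theory (X : Ext) (Γ : Form → Set) : Set where
  field
    contains-LIK : ∀ A → LIK X A → Γ A
    closed-mp    : ∀ A B → Γ (A ⊃ B) → Γ A → Γ B

-- Both D and T make □ A ⊃ ◇ A derivable: with T it is the composite of
-- □ A ⊃ A and A ⊃ ◇ A; with D, □ A gives □ (⊤ ⊃ A), which the axiom
-- □ (p ⊃ q) ⊃ ◇ p ⊃ ◇ q transports along ◇ ⊤.  A theory contains every
-- derivable implication, so it is closed under it.
module Submission where

open import Defs
open import Data.Bool using (true)
open import Data.Sum using (_⊎_; inj₁; inj₂)
open import Relation.Binary.PropositionalEquality using (_≡_)

module _ {X : Ext} where

  ⊃-trans : ∀ {A B C} → LIK X (A ⊃ B) → LIK X (B ⊃ C) → LIK X (A ⊃ C)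
  ⊃-trans {A} {B} {C} A⊃B B⊃C = mp (mp (ax-S A B C) (mp (ax-K _ A) B⊃C)) A⊃B

  ⊃-discharge : ∀ {A B C} → LIK X (A ⊃ B ⊃ C) → LIK X B → LIK X (A ⊃ C)
  ⊃-discharge {A} {B} {C} A⊃B⊃C b = mp (mp (ax-S A B C) A⊃B⊃C) (mp (ax-K B A) b)

  ∧-proj₁ : ∀ {A B} → LIK X (A ∧' B) → LIK X A
  ∧-proj₁ = mp (ax-∧₁ _ _)

  ∧-proj₂ : ∀ {A B} → LIK X (A ∧' B) → LIK X B
  ∧-proj₂ = mp (ax-∧₂ _ _)

  □⊃□[⊤⊃] : ∀ A → LIK X (□ A ⊃ □ (⊤' ⊃ A))
  □⊃□[⊤⊃] A = mp (ax-K□ A (⊤' ⊃ A)) (nec (ax-K A ⊤'))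

  □⊃◇-D : hasD X ≡ true → ∀ A → LIK X (□ A ⊃ ◇ A)
  □⊃◇-D d A = ⊃-trans (□⊃□[⊤⊃] A) (⊃-discharge (ax-K◇ ⊤' A) (ax-D d))

  □⊃◇-T : hasT X ≡ true → ∀ A → LIK X (□ A ⊃ ◇ A)
  □⊃◇-T t A = ⊃-trans (∧-proj₁ (ax-T t A)) (∧-proj₂ (ax-T t A))

  □⊃◇ : hasD X ≡ true ⊎ hasT X ≡ true → ∀ A → LIK X (□ A ⊃ ◇ A)
  □⊃◇ (inj₁ d) = □⊃◇-D d
  □⊃◇ (inj₂ t) = □⊃◇-T t

theory-closed-under-⊃ : ∀ {X Γ} → Theory X Γ → ∀ {A B} → LIK X (A ⊃ B) → Γ A → Γ B
theory-closed-under-⊃ th A⊃B = closed-mp _ _ (contains-LIK _ A⊃B)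
  where open Theory th

lemma3 : (X : Ext) → (hasD X ≡ true ⊎ hasT X ≡ true) →
    (Γ : Form → Set) → Theory X Γ →
    ∀ A → Γ (□ A) → Γ (◇ A)
lemma3 X D-or-T Γ th A = theory-closed-under-⊃ th (□⊃◇ D-or-T A)
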